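{- Let $k\in\mathbb{Z}$ and $n,d\in\mathbb{Z}^+$ with $n$ even. If $T_{2,d}$ admits a closed coloring $\ell$ with remainder $k\bmod n$, then for each level of $T_{2,d}$, all the integer labels $\ell(v)$ of vertices $v$ in that level have the same parity.
   Context: $T_{2,d}$ is the rooted perfect binary tree of height $d$: the root is at level $0$, every vertex at level $i<d$ has exactly two children at level $i+1$, and level $d$ consists of leaves. A closed coloring with remainder $k\bmod n$ of a graph $G=(V,E)$ is a map $\ell:V\to\mathbb{Z}$ with $\sum_{w\in N[v]}\ell(w)\equiv k\pmod n$ for every $v\in V$, where $N[v]$ is the closed neighborhood of $v$. -}

module Defs where

open import Data.Nat as ℕ using (ℕ; zero; suc; _∸_; _^_)
open import Data.Nat.Logarithm using (⌊log₂_⌋)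
open import Data.Fin using (Fin; toℕ)
open import Data.Fin.Properties using (_≟_)
open import Data.Integer as ℤ using (ℤ; +_)
open import Data.Integer.Divisibility using (_∣_)
open import Data.Sum using (_⊎_)
open import Relation.Nullary using (Dec; yes; no)
open import Relation.Nullary.Decidable using (_⊎-dec_)
open import Relation.Binary.PropositionalEquality using (_≡_)
open import Level using (0ℓ)
open import Relation.Binary using (Decidable)

record Graph : Set₁ where
  field
    size : ℕ
    Adj  : Fin size → Fin size → Set
    adj? : Decidable Adj
open Graph public

sumFin : (N : ℕ) → (Fin N → ℤ) → ℤ
sumFin zero    f = + 0
sumFin (suc N) f = f Fin.zero ℤ.+ sumFin N (λ i → f (Fin.suc i))

InClosedNbhd : (G : Graph) → Fin (size G) → Fin (size G) → Set
InClosedNbhd G v w = (w ≡ v) ⊎ Adj G v w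

inClosedNbhd? : (G : Graph) → (v w : Fin (size G)) → Dec (InClosedNbhd G v w)
inClosedNbhd? G v w = (w ≟ v) ⊎-dec adj? G v w

closedSum : (G : Graph) → (Fin (size G) → ℤ) → Fin (size G) → ℤ
closedSum G ℓ v = sumFin (size G) (λ w → pick (inClosedNbhd? G v w) (ℓ w))
  where
    pick : ∀ {P : Set} → Dec P → ℤ → ℤ
    pick (yes _) x = x
    pick (no _)  _ = + 0

_≡_[mod_] : ℤ → ℤ → ℕ → Set
a ≡ b [mod n ] = (+ n) ∣ (a ℤ.- b)

IsClosedColoring : (G : Graph) → ℤ → ℕ → (Fin (size G) → ℤ) → Set
IsClosedColoring G k n ℓ = ∀ v → closedSum G ℓ v ≡ k [mod n ]

-- Perfect binary tree T_{2,d} in heap numbering: vertex t : Fin (2^(d+1) - 1)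
-- has label a = t+1; the root has label 1, and the children of label a are
-- 2a and 2a+1.  The level of label a is ⌊log₂ a⌋.
heapLabel : ∀ {N} → Fin N → ℕ
heapLabel t = suc (toℕ t)

IsChild : ℕ → ℕ → Set
IsChild a b = (b ≡ 2 ℕ.* a) ⊎ (b ≡ suc (2 ℕ.* a))

isChild? : (a b : ℕ) → Dec (IsChild a b)
isChild? a b = (b ℕ.≟ 2 ℕ.* a) ⊎-dec (b ℕ.≟ suc (2 ℕ.* a))

TreeAdj : ∀ {N} → Fin N → Fin N → Set
TreeAdj s t = IsChild (heapLabel s) (heapLabel t) ⊎ IsChild (heapLabel t) (heapLabel s)

T₂ : ℕ → Graph
T₂ d = record
  { size = 2 ^ suc d ∸ 1
  ; Adj  = TreeAdj
  ; adj? = λ s t → isChild? (heapLabel s) (heapLabel t) ⊎-dec isChild? (heapLabel t) (heapLabel s)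
  }

level : ∀ {N} → Fin N → ℕ
level t = ⌊log₂ heapLabel t ⌋

-- Modulo 2 (n is even) the condition at vertex a of the heap-numbered tree reads
-- ℓ(a) + ℓ(2a) + ℓ(2a+1) + ℓ(⌊a/2⌋) ≡ k, absent vertices counting as 0.  At a leaf
-- this is ℓ(a) + ℓ(⌊a/2⌋) ≡ k; at an inner vertex, subtracting the same relation for
-- both children (known by downward induction) and using 2ℓ(a) ≡ 0 gives it again.
-- So every vertex satisfies ℓ(a) ≡ k − ℓ(parent), and induction on the level shows
-- that the parity of ℓ is constant on each level.
module Submission where

open import Defs
open import Data.Nat using (ℕ; _<_; _≥_)
open import Data.Nat.Divisibility as ℕD using ()
open import Data.Integer using (ℤ; _-_)
open import Data.Integer.Divisibility using (_∣_)
open import Data.Fin using (Fin)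
open import Relation.Binary.PropositionalEquality using (_≡_)

open import Data.Nat as ℕ using (zero; suc; _*_; _≤_; z≤n; s≤s; ⌊_/2⌋; _^_; _∸_)
import Data.Nat.Properties as ℕP
open import Data.Nat.Logarithm using (⌊log₂_⌋; ⌊log₂⌊n/2⌋⌋≡⌊log₂n⌋∸1)
open import Data.Integer using (+_; _+_; ∣_∣)
import Data.Integer.Properties as ℤP
import Data.Integer.Divisibility.Signed as S
open import Data.Integer.Solver using (module +-*-Solver)
open import Data.Fin using (zero; suc; fromℕ<)
import Data.Fin.Properties as FP
open import Algebra.Properties.CommutativeMonoid.Sum ℤP.+-0-commutativeMonoid
  using (sum; ∑-distrib-+; sum-cong-≗; sum-replicate-zero; sum-syntax)
open import Data.Sum using (_⊎_; inj₁; inj₂)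
open import Data.Product using (∃; _×_; _,_)
open import Relation.Nullary using (Dec; yes; no; ¬_; contradiction)
open import Relation.Nullary.Decidable using (_⊎-dec_)
open import Relation.Binary.PropositionalEquality
  using (_≢_; refl; sym; trans; cong; cong₂; subst; subst₂; module ≡-Reasoning)

open +-*-Solver

keepIf : {P : Set} → Dec P → ℤ → ℤ
keepIf (yes _) x = x
keepIf (no _)  _ = + 0

keepIf-yes : {P : Set} (d : Dec P) (x : ℤ) → P → keepIf d x ≡ x
keepIf-yes (yes _) x p = refl
keepIf-yes (no ¬p) x p = contradiction p ¬p

keepIf-no : {P : Set} (d : Dec P) (x : ℤ) → ¬ P → keepIf d x ≡ + 0
keepIf-no (yes p) x ¬p = contradiction p ¬p
keepIf-no (no _)  x ¬p = refl

keepIf-⇔ : {A B : Set} (a : Dec A) (b : Dec B) (x : ℤ) → (A → B) → (B → A) →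
           keepIf a x ≡ keepIf b x
keepIf-⇔ (yes _) (yes _) x f g = refl
keepIf-⇔ (yes p) (no ¬q) x f g = contradiction (f p) ¬q
keepIf-⇔ (no ¬p) (yes q) x f g = contradiction (g q) ¬p
keepIf-⇔ (no _)  (no _)  x f g = refl

keepIf-⊎ : {A B : Set} (a : Dec A) (b : Dec B) (x : ℤ) → ¬ (A × B) →
           keepIf (a ⊎-dec b) x ≡ keepIf a x + keepIf b x
keepIf-⊎ (yes p) (yes q) x disjoint = contradiction (p , q) disjoint
keepIf-⊎ (yes _) (no _)  x disjoint = sym (ℤP.+-identityʳ x)
keepIf-⊎ (no _)  (yes _) x disjoint = sym (ℤP.+-identityˡ x)
keepIf-⊎ (no _)  (no _)  x disjoint = refl

sumFin≡sum : ∀ N (f : Fin N → ℤ) → sumFin N f ≡ sum f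
sumFin≡sum zero    f = refl
sumFin≡sum (suc N) f = cong (_+_ (f zero)) (sumFin≡sum N (λ i → f (suc i)))

sum-zero : ∀ {N} (f : Fin N → ℤ) → (∀ i → f i ≡ + 0) → sum f ≡ + 0
sum-zero {N} f f≡0 = trans (sum-cong-≗ f≡0) (sum-replicate-zero N)

sum-single : ∀ {N} (f : Fin N → ℤ) (u : Fin N) → (∀ i → i ≢ u → f i ≡ + 0) → sum f ≡ f u
sum-single f zero vanish = begin
  f zero + sum (λ i → f (suc i))
    ≡⟨ cong (_+_ (f zero)) (sum-zero _ (λ i → vanish (suc i) (λ ()))) ⟩
  f zero + + 0
    ≡⟨ ℤP.+-identityʳ (f zero) ⟩
  f zero ∎
  where open ≡-Reasoning
sum-single f (suc u) vanish = begin
  f zero + sum (λ i → f (suc i))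
    ≡⟨ cong₂ _+_ (vanish zero (λ ())) (sum-single _ u (λ i i≢u → vanish (suc i) (λ { refl → i≢u refl }))) ⟩
  + 0 + f (suc u)
    ≡⟨ ℤP.+-identityˡ (f (suc u)) ⟩
  f (suc u) ∎
  where open ≡-Reasoning

-- The selector inside closedSum is local to Defs; unification against
-- refl recovers the summand so that it can be inspected.
private
  summandOf : ∀ {N} {f : Fin N → ℤ} (s : ℤ) → s ≡ sumFin N f → Fin N → ℤ
  summandOf {f = f} _ _ = f

closedSum≡∑ : ∀ G (ℓ : Fin (size G) → ℤ) v →
              closedSum G ℓ v ≡ ∑[ w < size G ] keepIf (inClosedNbhd? G v w) (ℓ w)
closedSum≡∑ G ℓ v = trans (sumFin≡sum (size G) summand) (sum-cong-≗ summand≗)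
  where
    summand : Fin (size G) → ℤ
    summand = summandOf (closedSum G ℓ v) refl
    summand≗ : ∀ w → summand w ≡ keepIf (inClosedNbhd? G v w) (ℓ w)
    summand≗ w with inClosedNbhd? G v w
    ... | yes _ = refl
    ... | no _  = refl

n<2*n : ∀ {n} → 1 ≤ n → n < 2 * n
n<2*n {suc n} _ = s≤s (ℕP.m<m+n n (s≤s z≤n))

IsChild⇒< : ∀ {a b} → 1 ≤ a → IsChild a b → a < b
IsChild⇒< 1≤a (inj₁ refl) = n<2*n 1≤a
IsChild⇒< 1≤a (inj₂ refl) = ℕP.m<n⇒m<1+n (n<2*n 1≤a)

⌊2*n/2⌋≡n : ∀ n → ⌊ 2 * n /2⌋ ≡ n
⌊2*n/2⌋≡n n = trans (cong (λ m → ⌊ n ℕ.+ m /2⌋) (ℕP.+-identityʳ n)) (sym (ℕP.n≡⌊n+n/2⌋ n))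

⌊1+2*n/2⌋≡n : ∀ n → ⌊ suc (2 * n) /2⌋ ≡ n
⌊1+2*n/2⌋≡n zero    = refl
⌊1+2*n/2⌋≡n (suc n) = cong suc (trans (cong ⌊_/2⌋ (ℕP.+-suc n (n ℕ.+ 0))) (⌊1+2*n/2⌋≡n n))

IsChild⇒≡⌊/2⌋ : ∀ {a b} → IsChild a b → a ≡ ⌊ b /2⌋
IsChild⇒≡⌊/2⌋ {a} (inj₁ refl) = sym (⌊2*n/2⌋≡n a)
IsChild⇒≡⌊/2⌋ {a} (inj₂ refl) = sym (⌊1+2*n/2⌋≡n a)

IsChild-⌊/2⌋ : ∀ b → IsChild ⌊ b /2⌋ b
IsChild-⌊/2⌋ zero          = inj₁ refl
IsChild-⌊/2⌋ (suc zero)    = inj₂ refl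
IsChild-⌊/2⌋ (suc (suc b)) with IsChild-⌊/2⌋ b
... | inj₁ b≡2h = inj₁ (trans (cong (λ m → 2 ℕ.+ m) b≡2h) (sym (ℕP.*-suc 2 ⌊ b /2⌋)))
... | inj₂ b≡1+2h = inj₂ (trans (cong (λ m → 2 ℕ.+ m) b≡1+2h) (cong suc (sym (ℕP.*-suc 2 ⌊ b /2⌋))))

⌊log₂⌋-⌊/2⌋ : ∀ a {i} → ⌊log₂ a ⌋ ≡ suc i → ⌊log₂ ⌊ a /2⌋ ⌋ ≡ i
⌊log₂⌋-⌊/2⌋ a eq = trans (⌊log₂⌊n/2⌋⌋≡⌊log₂n⌋∸1 a) (cong (_∸ 1) eq)

heapLabel-injective : ∀ {N} {u w : Fin N} → heapLabel u ≡ heapLabel w → u ≡ w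
heapLabel-injective eq = FP.toℕ-injective (ℕP.suc-injective eq)

heapLabel-surjective : ∀ {N a} → 1 ≤ a → a ≤ N → ∃ λ (u : Fin N) → heapLabel u ≡ a
heapLabel-surjective {a = suc j} _ j<N = fromℕ< j<N , cong suc (FP.toℕ-fromℕ< j<N)

size-T₂ : ∀ d → size (T₂ d) ≡ suc (2 * (2 ^ d ∸ 1))
size-T₂ d = 2*n∸1 (2 ^ d) (ℕP.m^n>0 2 d)
  where
    2*n∸1 : ∀ n → 1 ≤ n → 2 * n ∸ 1 ≡ suc (2 * (n ∸ 1))
    2*n∸1 (suc n) _ = ℕP.+-suc n (n ℕ.+ 0)

leaf-or-internal : ∀ {N} M → N ≡ suc (2 * M) → ∀ a → N < 2 * a ⊎ suc (2 * a) ≤ N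
leaf-or-internal M refl a with a ℕ.≤? M
... | yes a≤M = inj₂ (s≤s (ℕP.*-monoʳ-≤ 2 a≤M))
... | no  a≰M = inj₁ (subst (_≤ 2 * a) (ℕP.*-suc 2 M) (ℕP.*-monoʳ-≤ 2 (ℕP.≰⇒> a≰M)))

closedHeapSum : (ℕ → ℤ) → ℕ → ℤ
closedHeapSum f a = f a + ((f (2 * a) + f (suc (2 * a))) + f ⌊ a /2⌋)

keepIf-inClosedNbhd-T₂ : ∀ d (v w : Fin (size (T₂ d))) x →
  keepIf (inClosedNbhd? (T₂ d) v w) x ≡ closedHeapSum (λ c → keepIf (heapLabel w ℕ.≟ c) x) (heapLabel v)
keepIf-inClosedNbhd-T₂ d v w x = begin
  keepIf ((w FP.≟ v) ⊎-dec (isChild? a b ⊎-dec isChild? b a)) x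
    ≡⟨ keepIf-⊎ (w FP.≟ v) _ x (λ { (refl , adj) → no-loop adj }) ⟩
  keepIf (w FP.≟ v) x + keepIf (isChild? a b ⊎-dec isChild? b a) x
    ≡⟨ cong₂ _+_ (keepIf-⇔ (w FP.≟ v) (b ℕ.≟ a) x (cong heapLabel) heapLabel-injective)
                 (keepIf-⊎ (isChild? a b) (isChild? b a) x
                    (λ (down , up) → ℕP.<-asym (IsChild⇒< (s≤s z≤n) down) (IsChild⇒< (s≤s z≤n) up))) ⟩
  keepIf (b ℕ.≟ a) x + (keepIf (isChild? a b) x + keepIf (isChild? b a) x)
    ≡⟨ cong (λ s → keepIf (b ℕ.≟ a) x + s)
         (cong₂ _+_ (keepIf-⊎ (b ℕ.≟ 2 * a) (b ℕ.≟ suc (2 * a)) x (λ (p , q) → ℕP.1+n≢n (trans (sym q) p)))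
                    (keepIf-⇔ (isChild? b a) (b ℕ.≟ ⌊ a /2⌋) x IsChild⇒≡⌊/2⌋
                      (λ eq → subst (λ c → IsChild c a) (sym eq) (IsChild-⌊/2⌋ a)))) ⟩
  closedHeapSum (λ c → keepIf (b ℕ.≟ c) x) a ∎
  where
    open ≡-Reasoning
    a b : ℕ
    a = heapLabel v
    b = heapLabel w
    no-loop : ¬ TreeAdj v v
    no-loop (inj₁ p) = ℕP.<-irrefl refl (IsChild⇒< (s≤s z≤n) p)
    no-loop (inj₂ p) = ℕP.<-irrefl refl (IsChild⇒< (s≤s z≤n) p)

∑-closedHeapSum : ∀ {N} (g : Fin N → ℕ → ℤ) a →
  ∑[ w < N ] closedHeapSum (g w) a ≡ closedHeapSum (λ c → ∑[ w < N ] g w c) a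
∑-closedHeapSum {N} g a = begin
  sum (λ w → A w + ((B w + C w) + D w))
    ≡⟨ ∑-distrib-+ A _ ⟩
  sum A + sum (λ w → (B w + C w) + D w)
    ≡⟨ cong (_+_ (sum A)) (∑-distrib-+ _ D) ⟩
  sum A + (sum (λ w → B w + C w) + sum D)
    ≡⟨ cong (λ s → sum A + (s + sum D)) (∑-distrib-+ B C) ⟩
  sum A + ((sum B + sum C) + sum D) ∎
  where
    open ≡-Reasoning
    A B C D : Fin N → ℤ
    A = λ w → g w a
    B = λ w → g w (2 * a)
    C = λ w → g w (suc (2 * a))
    D = λ w → g w ⌊ a /2⌋

-- Labels that no vertex carries (0 and those beyond N) get the value 0; they stand
-- for the root's missing parent and the leaves' missing children in closedHeapSum.
atLabel : ∀ {N} → (Fin N → ℤ) → ℕ → ℤ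
atLabel {N} ℓ c = ∑[ w < N ] keepIf (heapLabel w ℕ.≟ c) (ℓ w)

atLabel-heapLabel : ∀ {N} (ℓ : Fin N → ℤ) u → atLabel ℓ (heapLabel u) ≡ ℓ u
atLabel-heapLabel ℓ u = trans (sum-single _ u vanish) (keepIf-yes (heapLabel u ℕ.≟ heapLabel u) (ℓ u) refl)
  where
    vanish : ∀ w → w ≢ u → keepIf (heapLabel w ℕ.≟ heapLabel u) (ℓ w) ≡ + 0
    vanish w w≢u = keepIf-no (heapLabel w ℕ.≟ heapLabel u) (ℓ w) (λ eq → w≢u (heapLabel-injective eq))

atLabel-beyond : ∀ {N} (ℓ : Fin N → ℤ) {c} → N < c → atLabel ℓ c ≡ + 0
atLabel-beyond ℓ N<c = sum-zero _ λ w →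
  keepIf-no (heapLabel w ℕ.≟ _) (ℓ w) (λ eq → ℕP.<-irrefl eq (ℕP.≤-<-trans (FP.toℕ<n w) N<c))

closedSum-T₂ : ∀ d (ℓ : Fin (size (T₂ d)) → ℤ) v →
  closedSum (T₂ d) ℓ v ≡ closedHeapSum (atLabel ℓ) (heapLabel v)
closedSum-T₂ d ℓ v = begin
  closedSum (T₂ d) ℓ v
    ≡⟨ closedSum≡∑ (T₂ d) ℓ v ⟩
  ∑[ w < size (T₂ d) ] keepIf (inClosedNbhd? (T₂ d) v w) (ℓ w)
    ≡⟨ sum-cong-≗ (λ w → keepIf-inClosedNbhd-T₂ d v w (ℓ w)) ⟩
  ∑[ w < size (T₂ d) ] closedHeapSum (λ c → keepIf (heapLabel w ℕ.≟ c) (ℓ w)) (heapLabel v)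
    ≡⟨ ∑-closedHeapSum (λ w c → keepIf (heapLabel w ℕ.≟ c) (ℓ w)) (heapLabel v) ⟩
  closedHeapSum (atLabel ℓ) (heapLabel v) ∎
  where open ≡-Reasoning

≡-mod-refl : ∀ m x → x ≡ x [mod m ]
≡-mod-refl m x = subst (λ t → m ℕD.∣ ∣ t ∣) (sym (ℤP.+-inverseʳ x)) (m ℕD.∣0)

≡-mod⇒∣ : ∀ m x y → x ≡ y [mod m ] → + m S.∣ (x - y)
≡-mod⇒∣ m _ _ = S.∣ᵤ⇒∣ {+ m}

≡-mod-cancel : ∀ m x y p q k → (x + p) ≡ k [mod m ] → (y + q) ≡ k [mod m ] → p ≡ q [mod m ] →
               x ≡ y [mod m ]
≡-mod-cancel m x y p q k xp≡k yq≡k p≡q =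
  S.∣⇒∣ᵤ (subst (+ m S.∣_) difference
    (S.∣m∣n⇒∣m-n (S.∣m∣n⇒∣m-n (≡-mod⇒∣ m (x + p) k xp≡k) (≡-mod⇒∣ m (y + q) k yq≡k)) (≡-mod⇒∣ m p q p≡q)))
  where
    difference : ((x + p) - k) - ((y + q) - k) - (p - q) ≡ x - y
    difference = solve 5 (λ x y p q k → ((x :+ p) :- k) :- ((y :+ q) :- k) :- (p :- q) := x :- y)
                   refl x y p q k

-- The two children's conditions together contain a twice, which vanishes modulo 2.
≡-mod2-drop-children : ∀ a h x y k → (a + ((x + y) + h)) ≡ k [mod 2 ] →
                       (x + a) ≡ k [mod 2 ] → (y + a) ≡ k [mod 2 ] → (a + h) ≡ k [mod 2 ]
≡-mod2-drop-children a h x y k nbhd≡k xa≡k ya≡k =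
  S.∣⇒∣ᵤ (subst (+ 2 S.∣_) difference
    (S.∣m∣n⇒∣m+n (S.∣m∣n⇒∣m-n (S.∣m∣n⇒∣m-n (≡-mod⇒∣ 2 (a + ((x + y) + h)) k nbhd≡k) (≡-mod⇒∣ 2 (x + a) k xa≡k))
                              (≡-mod⇒∣ 2 (y + a) k ya≡k))
                 (S.divides (a - k) (solve 2 (λ a k → (a :- k) :+ (a :- k) := (a :- k) :* con (+ 2)) refl a k))))
  where
    difference : (a + ((x + y) + h) - k) - (x + a - k) - (y + a - k) + ((a - k) + (a - k)) ≡ a + h - k
    difference = solve 5 (λ a h x y k → (a :+ ((x :+ y) :+ h) :- k) :- (x :+ a :- k) :- (y :+ a :- k)
                                        :+ ((a :- k) :+ (a :- k)) := a :+ h :- k)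
                   refl a h x y k

module _ {N : ℕ} (M : ℕ) (N≡1+2M : N ≡ suc (2 * M))
         (f : ℕ → ℤ) (f-beyond : ∀ {c} → N < c → f c ≡ + 0) (k : ℤ)
         (closed : ∀ {a} → 1 ≤ a → a ≤ N → closedHeapSum f a ≡ k [mod 2 ]) where

  -- Downward induction: the fuel j bounds N ∸ a.
  private
    withParent′ : ∀ j {a} → N ≤ j ℕ.+ a → 1 ≤ a → a ≤ N → (f a + f ⌊ a /2⌋) ≡ k [mod 2 ]
    withParent′ j {a} N≤j+a 1≤a a≤N with leaf-or-internal M N≡1+2M a
    ... | inj₁ N<2a = subst (λ s → s ≡ k [mod 2 ]) childless (closed 1≤a a≤N)
      where
        childless : closedHeapSum f a ≡ f a + f ⌊ a /2⌋
        childless rewrite f-beyond N<2a | f-beyond (ℕP.m<n⇒m<1+n N<2a) =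
          cong (_+_ (f a)) (ℤP.+-identityˡ _)
    ... | inj₂ 1+2a≤N with j
    ...   | zero   = contradiction (ℕP.<-≤-trans (s≤s (ℕP.<⇒≤ (n<2*n 1≤a))) 1+2a≤N) (ℕP.≤⇒≯ N≤j+a)
    ...   | suc j′ =
      ≡-mod2-drop-children (f a) (f ⌊ a /2⌋) (f (2 * a)) (f (suc (2 * a))) k (closed 1≤a a≤N)
        (subst (λ p → (f (2 * a) + f p) ≡ k [mod 2 ]) (⌊2*n/2⌋≡n a)
           (withParent′ j′ N≤j′+2a (ℕP.≤-trans 1≤a (ℕP.<⇒≤ (n<2*n 1≤a))) (ℕP.<⇒≤ 1+2a≤N)))
        (subst (λ p → (f (suc (2 * a)) + f p) ≡ k [mod 2 ]) (⌊1+2*n/2⌋≡n a)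
           (withParent′ j′ (ℕP.≤-trans N≤j′+2a (ℕP.+-monoʳ-≤ j′ (ℕP.n≤1+n _))) (s≤s z≤n) 1+2a≤N))
      where
        N≤j′+2a : N ≤ j′ ℕ.+ 2 * a
        N≤j′+2a = ℕP.≤-trans N≤j+a
                    (ℕP.≤-trans (ℕP.≤-reflexive (sym (ℕP.+-suc j′ a))) (ℕP.+-monoʳ-≤ j′ (n<2*n 1≤a)))

  ≡-mod2-withParent : ∀ {a} → 1 ≤ a → a ≤ N → (f a + f ⌊ a /2⌋) ≡ k [mod 2 ]
  ≡-mod2-withParent {a} = withParent′ N (ℕP.m≤m+n N a)

  ≡-mod2-sameLevel : ∀ i {a b} → 1 ≤ a → a ≤ N → 1 ≤ b → b ≤ N →
                     ⌊log₂ a ⌋ ≡ i → ⌊log₂ b ⌋ ≡ i → f a ≡ f b [mod 2 ]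
  ≡-mod2-sameLevel i {1} {1} _ _ _ _ _ _ = ≡-mod-refl 2 (f 1)
  ≡-mod2-sameLevel i {1} {suc (suc b)} _ _ _ _ a-lvl b-lvl = contradiction (trans a-lvl (sym b-lvl)) λ ()
  ≡-mod2-sameLevel i {suc (suc a)} {1} _ _ _ _ a-lvl b-lvl = contradiction (trans b-lvl (sym a-lvl)) λ ()
  ≡-mod2-sameLevel zero {suc (suc a)} {suc (suc b)} _ _ _ _ () _
  ≡-mod2-sameLevel (suc i) {a@(suc (suc _))} {b@(suc (suc _))} _ a≤N _ b≤N a-lvl b-lvl =
    ≡-mod-cancel 2 (f a) (f b) (f ⌊ a /2⌋) (f ⌊ b /2⌋) k
      (≡-mod2-withParent (s≤s z≤n) a≤N) (≡-mod2-withParent (s≤s z≤n) b≤N)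
      (≡-mod2-sameLevel i (s≤s z≤n) (ℕP.≤-trans (ℕP.⌊n/2⌋≤n a) a≤N) (s≤s z≤n) (ℕP.≤-trans (ℕP.⌊n/2⌋≤n b) b≤N)
         (⌊log₂⌋-⌊/2⌋ a a-lvl) (⌊log₂⌋-⌊/2⌋ b b-lvl))

lemma6p2 : (k : ℤ) (n d : ℕ) → 0 < n → d ≥ 1 → 2 ℕD.∣ n →
    (ℓ : Fin (Graph.size (T₂ d)) → ℤ) → IsClosedColoring (T₂ d) k n ℓ →
    ∀ (v w : Fin (Graph.size (T₂ d))) → level v ≡ level w →
    ℓ v ≡ ℓ w [mod 2 ]
lemma6p2 k n d _ _ 2∣n ℓ coloring v w same-level =
  subst₂ (λ x y → x ≡ y [mod 2 ]) (atLabel-heapLabel ℓ v) (atLabel-heapLabel ℓ w)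
    (≡-mod2-sameLevel (2 ^ d ∸ 1) (size-T₂ d) (atLabel ℓ) (atLabel-beyond ℓ) k closed
       (level w) {heapLabel v} {heapLabel w} (s≤s z≤n) (FP.toℕ<n v) (s≤s z≤n) (FP.toℕ<n w) same-level refl)
  where
    closed : ∀ {a} → 1 ≤ a → a ≤ size (T₂ d) → closedHeapSum (atLabel ℓ) a ≡ k [mod 2 ]
    closed 1≤a a≤N with heapLabel-surjective 1≤a a≤N
    ... | u , refl = subst (λ s → s ≡ k [mod 2 ]) (closedSum-T₂ d ℓ u) (ℕD.∣-trans 2∣n (coloring u))
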